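{- Let $B_n=K_{1,n}\,\square\, P_2$ denote the $n$-book graph (Cartesian product of the star $K_{1,n}$ with the path $P_2$ on two vertices). Then (i) $\pi(B_2)=8$, and (ii) $\pi(B_n)=2n+4$ for every $n\ge 2$.
   Context: Let $G=(V,E)$ be a simple graph. A configuration is a function $\phi:V\to\mathbb{N}\cup\{0\}$; its size is $\sum_{u\in V}\phi(u)$. A pebbling step from a vertex $u$ to a neighbour $v$ removes two pebbles from $u$ and adds one pebble to $v$. For a target vertex $r$, $\phi$ is $r$-solvable if some sequence of pebbling steps places at least one pebble on $r$. $\pi(G,r)$ is the minimum positive integer $m$ such that every configuration of size $m$ is $r$-solvable, and $\pi(G)=\max_{r\in V}\pi(G,r)$ is the pebbling number. -}

module Defs where

open import Data.Nat using (ℕ; zero; suc; _+_; _*_; _∸_; _≤_; _<_)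
open import Data.Fin using (Fin; zero; suc; remQuot; _≟_)
open import Data.Product using (Σ; ∃; _×_; _,_)
open import Data.Sum using (_⊎_)
open import Relation.Nullary using (¬_; yes; no)
open import Relation.Binary.PropositionalEquality using (_≡_; _≢_)

-- A simple graph on the vertex set Fin order, given by an adjacency relation.
-- (All graphs built below are simple: Adj is symmetric and irreflexive.)
record Graph : Set₁ where
  field
    order : ℕ
    Adj   : Fin order → Fin order → Set
open Graph public

star : ℕ → Graph
star n = record
  { order = suc n
  ; Adj   = λ i j → (i ≡ zero × j ≢ zero) ⊎ (i ≢ zero × j ≡ zero) }

P2 : Graph
P2 = record { order = 2 ; Adj = λ i j → i ≢ j }

-- Cartesian product G □ H on vertex set Fin (|G| * |H|), where a vertex x
-- encodes the pair remQuot |H| x : Fin |G| × Fin |H|.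
_□_ : Graph → Graph → Graph
G □ H = record
  { order = order G * order H
  ; Adj   = λ x y → CAdj (remQuot (order H) x) (remQuot (order H) y) }
  where
  CAdj : Fin (order G) × Fin (order H) → Fin (order G) × Fin (order H) → Set
  CAdj (u , v) (u' , v') = (Adj G u u' × v ≡ v') ⊎ (u ≡ u' × Adj H v v')

book : ℕ → Graph
book n = star n □ P2

Config : Graph → Set
Config G = Fin (order G) → ℕ

sumFin : ∀ k → (Fin k → ℕ) → ℕ
sumFin zero    f = 0
sumFin (suc k) f = f zero + sumFin k (λ i → f (suc i))

size : (G : Graph) → Config G → ℕ
size G φ = sumFin (order G) φ

move : (G : Graph) → Config G → Fin (order G) → Fin (order G) → Config G
move G φ u v w with w ≟ u | w ≟ v
... | yes _ | yes _ = (φ w ∸ 2) + 1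
... | yes _ | no  _ = φ w ∸ 2
... | no  _ | yes _ = φ w + 1
... | no  _ | no  _ = φ w

data Solvable (G : Graph) (r : Fin (order G)) : Config G → Set where
  done : ∀ {φ} → 1 ≤ φ r → Solvable G r φ
  step : ∀ {φ} (u v : Fin (order G)) → Adj G u v → 2 ≤ φ u →
         Solvable G r (move G φ u v) → Solvable G r φ

IsRootedPebblingNumber : (G : Graph) → Fin (order G) → ℕ → Set
IsRootedPebblingNumber G r m =
  1 ≤ m
  × (∀ (φ : Config G) → size G φ ≡ m → Solvable G r φ)
  × (∀ k → 1 ≤ k → k < m → Σ (Config G) λ φ → size G φ ≡ k × ¬ Solvable G r φ)

IsPebblingNumber : Graph → ℕ → Set
IsPebblingNumber G p =
  (∀ r → Σ ℕ λ m → IsRootedPebblingNumber G r m × m ≤ p)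
  × (Σ (Fin (order G)) λ r → IsRootedPebblingNumber G r p)

-- Write B_n with columns 0 … n, column 0 (the spine) lying over the centre of the star, and
-- two levels. For a spine root, one pebble on every other vertex admits no move, so 2n + 2
-- pebbles are needed. For a leaf root r in column j, weigh a pebble 8 on r and 4, 2 at distance
-- 1, 2 from r, and every other column by what it can deliver to the spine: this potential never
-- increases under a move and is at least 8 once r holds a pebble, while seven pebbles on the
-- far vertex of one further column and one on each vertex of the remaining columns have
-- potential 6 and size 2n + 3.
-- For the upper bounds, the core (the spine, and column j for a leaf root) has a deficiency
-- counting the pebbles still missing beyond two on each of the other, ordinary, columns. These
-- are drained into the spine one at a time: a column holding c ≥ 3 pebbles, sent to the spine
-- after at most one move inside it, lowers the deficiency by c − 2 (a finite fact, checked by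
-- evaluation), and once the deficiency vanishes the core alone reaches the root.

module Submission where

open import Defs
open import Data.Nat using (ℕ; zero; suc; _+_; _*_; _∸_; _≤_; _<_; z≤n; s≤s; _≤?_; _<?_; ⌊_/2⌋)
import Data.Nat as Nat
open import Data.Nat.Properties hiding (_≟_; suc-injective)
open import Data.Nat.Tactic.RingSolver using (solve-∀)
open import Data.Fin using (Fin; zero; suc; toℕ; fromℕ<; punchIn; combine; remQuot; opposite; _≟_)
open import Data.Fin.Properties
  using ( punchInᵢ≢i; punchIn-injective; suc-injective; remQuot-combine; combine-remQuot; combine-injective
        ; toℕ-fromℕ<; all?)
open import Data.Vec.Functional using (updateAt; removeAt)
open import Data.Vec.Functional.Properties using (updateAt-updates; updateAt-minimal)
open import Algebra.Properties.CommutativeMonoid.Sum +-0-commutativeMonoid using (sum; sum-remove)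
open import Data.Bool using (if_then_else_)
open import Data.Product using (Σ; _×_; _,_; proj₁; proj₂; uncurry)
open import Data.Sum using (_⊎_; inj₁; inj₂)
open import Function using (_∘_; id; const; flip)
open import Function.Definitions using (Injective)
open import Relation.Binary.PropositionalEquality
open import Relation.Nullary using (¬_; Dec; yes; no; does; contradiction)
open import Relation.Nullary.Decidable using (from-yes; dec-true; _×-dec_; _⊎-dec_; _→-dec_)

sumFin-cong : ∀ k {f g : Fin k → ℕ} → (∀ i → f i ≡ g i) → sumFin k f ≡ sumFin k g
sumFin-cong zero    f≗g = refl
sumFin-cong (suc k) f≗g = cong₂ _+_ (f≗g zero) (sumFin-cong k (f≗g ∘ suc))

sumFin-mono : ∀ k {f g : Fin k → ℕ} → (∀ i → f i ≤ g i) → sumFin k f ≤ sumFin k g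
sumFin-mono zero    f≤g = z≤n
sumFin-mono (suc k) f≤g = +-mono-≤ (f≤g zero) (sumFin-mono k (f≤g ∘ suc))

sumFin-const : ∀ k c → sumFin k (const c) ≡ k * c
sumFin-const zero    c = refl
sumFin-const (suc k) c = cong (c +_) (sumFin-const k c)

sumFin≡sum : ∀ k (f : Fin k → ℕ) → sumFin k f ≡ sum f
sumFin≡sum zero    f = refl
sumFin≡sum (suc k) f = cong (f zero +_) (sumFin≡sum k (f ∘ suc))

sumFin-remove : ∀ k (f : Fin (suc k) → ℕ) p → sumFin (suc k) f ≡ f p + sumFin k (removeAt f p)
sumFin-remove k f p = begin
  sumFin (suc k) f                ≡⟨ sumFin≡sum (suc k) f ⟩
  sum f                           ≡⟨ sum-remove f ⟩
  f p + sum (removeAt f p)        ≡⟨ cong (f p +_) (sumFin≡sum k (removeAt f p)) ⟨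
  f p + sumFin k (removeAt f p)   ∎
  where open ≡-Reasoning

sumFin-lookup : ∀ k (f : Fin k → ℕ) p → f p ≤ sumFin k f
sumFin-lookup (suc k) f p = ≤-trans (m≤m+n (f p) _) (≤-reflexive (sym (sumFin-remove k f p)))

sumFin-updateAt : ∀ k (f : Fin k → ℕ) p g → sumFin k (updateAt f p g) + f p ≡ sumFin k f + g (f p)
sumFin-updateAt (suc k) f p g = begin
  sumFin (suc k) f′ + f p                          ≡⟨ cong (_+ f p) (sumFin-remove k f′ p) ⟩
  f′ p + sumFin k (removeAt f′ p) + f p            ≡⟨ cong (λ s → f′ p + s + f p) rest ⟩
  f′ p + sumFin k (removeAt f p) + f p             ≡⟨ cong (λ x → x + _ + f p) (updateAt-updates p f) ⟩
  g (f p) + sumFin k (removeAt f p) + f p          ≡⟨ shuffle (g (f p)) _ (f p) ⟩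
  (f p + sumFin k (removeAt f p)) + g (f p)        ≡⟨ cong (_+ g (f p)) (sumFin-remove k f p) ⟨
  sumFin (suc k) f + g (f p)                       ∎
  where
  open ≡-Reasoning
  f′ : Fin (suc k) → ℕ
  f′ = updateAt f p g
  rest : sumFin k (removeAt f′ p) ≡ sumFin k (removeAt f p)
  rest = sumFin-cong k (λ i → updateAt-minimal (punchIn p i) p f (punchInᵢ≢i p i))
  shuffle : ∀ a s b → a + s + b ≡ (b + s) + a
  shuffle = solve-∀

sumFin-split : ∀ k (f : Fin k → ℕ) m → m ≤ sumFin k f →
               Σ (Fin k → ℕ) λ g → (∀ i → g i ≤ f i) × sumFin k g ≡ m
sumFin-split zero f zero z≤n = f , (λ ()) , refl
sumFin-split (suc k) f m m≤ with m ≤? sumFin k (f ∘ suc)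
... | yes m≤rest with sumFin-split k (f ∘ suc) m m≤rest
...   | g , g≤f , Σg = (λ { zero → 0 ; (suc i) → g i }) , (λ { zero → z≤n ; (suc i) → g≤f i }) , Σg
sumFin-split (suc k) f m m≤ | no m≰rest =
  (λ { zero → m ∸ rest ; (suc i) → f (suc i) }) ,
  (λ { zero → m≤n+o⇒m∸n≤o m rest (subst (m ≤_) (+-comm (f zero) rest) m≤) ; (suc i) → ≤-refl }) ,
  m∸n+n≡m (≤-trans (n≤1+n rest) (≰⇒> m≰rest))
  where
  rest : ℕ
  rest = sumFin k (f ∘ suc)

sumFin-≤-two : ∀ k (X Y : Fin k → ℕ) {p q} → p ≢ q → (∀ i → i ≢ p → i ≢ q → X i ≡ Y i) →
               X p + X q ≤ Y p + Y q → sumFin k X ≤ sumFin k Y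
sumFin-≤-two k X Y {p} {q} p≢q X≡Y le = +-cancelʳ-≤ (Y p + Y q) _ _ (begin
  sumFin k X + (Y p + Y q)       ≡⟨ cong (_+ (Y p + Y q)) (sumFin-cong k X≗Z) ⟩
  sumFin k Z + (Y p + Y q)       ≡⟨ swap (sumFin k Z) (Y p) (Y q) ⟩
  sumFin k Z + Y q + Y p         ≡⟨ cong (λ y → sumFin k Z + y + Y p) (updateAt-minimal q p Y (p≢q ∘ sym)) ⟨
  sumFin k Z + Y′ q + Y p        ≡⟨ cong (_+ Y p) (sumFin-updateAt k Y′ q (const (X q))) ⟩
  sumFin k Y′ + X q + Y p        ≡⟨ swap′ (sumFin k Y′) (X q) (Y p) ⟩
  sumFin k Y′ + Y p + X q        ≡⟨ cong (_+ X q) (sumFin-updateAt k Y p (const (X p))) ⟩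
  sumFin k Y + X p + X q         ≡⟨ +-assoc (sumFin k Y) (X p) (X q) ⟩
  sumFin k Y + (X p + X q)       ≤⟨ +-monoʳ-≤ (sumFin k Y) le ⟩
  sumFin k Y + (Y p + Y q)       ∎)
  where
  open ≤-Reasoning
  Y′ Z : Fin k → ℕ
  Y′ = updateAt Y p (const (X p))
  Z = updateAt Y′ q (const (X q))
  X≗Z : ∀ i → X i ≡ Z i
  X≗Z i with i ≟ q | i ≟ p
  ... | yes refl | _        = sym (updateAt-updates q Y′)
  ... | no i≢q   | yes refl = sym (trans (updateAt-minimal p q Y′ i≢q) (updateAt-updates p Y))
  ... | no i≢q   | no i≢p   =
    trans (X≡Y i i≢p i≢q) (sym (trans (updateAt-minimal i q Y′ i≢q) (updateAt-minimal i p Y i≢p)))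
  swap : ∀ s a b → s + (a + b) ≡ s + b + a
  swap = solve-∀
  swap′ : ∀ s a b → s + a + b ≡ s + b + a
  swap′ = solve-∀

-- Pebbling on an arbitrary graph

module _ {G : Graph} where

  private
    V : Set
    V = Fin (order G)

  _≤ᶜ_ : Config G → Config G → Set
  φ ≤ᶜ ψ = ∀ w → φ w ≤ ψ w

  move-source : ∀ φ {u v : V} → u ≢ v → move G φ u v u ≡ φ u ∸ 2
  move-source φ {u} {v} u≢v with u ≟ u | u ≟ v
  ... | yes _   | yes u≡v = contradiction u≡v u≢v
  ... | yes _   | no _    = refl
  ... | no u≢u  | _       = contradiction refl u≢u

  move-target : ∀ φ {u v : V} → u ≢ v → move G φ u v v ≡ suc (φ v)
  move-target φ {u} {v} u≢v with v ≟ u | v ≟ v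
  ... | yes v≡u | _       = contradiction (sym v≡u) u≢v
  ... | no _    | yes _   = +-comm (φ v) 1
  ... | no _    | no v≢v  = contradiction refl v≢v

  move-other : ∀ φ {u v w : V} → w ≢ u → w ≢ v → move G φ u v w ≡ φ w
  move-other φ {u} {v} {w} w≢u w≢v with w ≟ u | w ≟ v
  ... | yes w≡u | _       = contradiction w≡u w≢u
  ... | no _    | yes w≡v = contradiction w≡v w≢v
  ... | no _    | no _    = refl

  move-mono : ∀ {φ ψ} u v → φ ≤ᶜ ψ → move G φ u v ≤ᶜ move G ψ u v
  move-mono u v φ≤ψ w with w ≟ u | w ≟ v
  ... | yes _ | yes _ = +-monoˡ-≤ 1 (∸-monoˡ-≤ 2 (φ≤ψ w))
  ... | yes _ | no  _ = ∸-monoˡ-≤ 2 (φ≤ψ w)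
  ... | no  _ | yes _ = +-monoˡ-≤ 1 (φ≤ψ w)
  ... | no  _ | no  _ = φ≤ψ w

  Solvable-mono : ∀ {r φ ψ} → φ ≤ᶜ ψ → Solvable G r φ → Solvable G r ψ
  Solvable-mono {r} φ≤ψ (done h) = done (≤-trans h (φ≤ψ r))
  Solvable-mono φ≤ψ (step u v a h s) =
    step u v a (≤-trans h (φ≤ψ u)) (Solvable-mono (move-mono u v φ≤ψ) s)

  -- ψ arises from φ by k pebbling steps from u to v; reachability is recorded through solvability.
  record Transfer (r : V) (φ ψ : Config G) (u v : V) (k : ℕ) : Set where
    field
      solvable : Solvable G r ψ → Solvable G r φ
      at-source : ψ u ≡ φ u ∸ 2 * k
      at-target : ψ v ≡ φ v + k
      elsewhere : ∀ w → w ≢ u → w ≢ v → ψ w ≡ φ w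

  transfer : ∀ (r : V) φ {u v} k → Adj G u v → u ≢ v → 2 * k ≤ φ u →
             Σ (Config G) λ ψ → Transfer r φ ψ u v k
  transfer r φ zero a u≢v h =
    φ , record { solvable = λ s → s ; at-source = refl
               ; at-target = sym (+-identityʳ _) ; elsewhere = λ _ _ _ → refl }
  transfer r φ {u} {v} (suc k) a u≢v h = ψ , record
    { solvable = λ s → step u v a (≤-trans (m≤n+m 2 (2 * k)) h′) (Transfer.solvable t s)
    ; at-source = begin
        ψ u                       ≡⟨ Transfer.at-source t ⟩
        move G φ u v u ∸ 2 * k    ≡⟨ cong (_∸ 2 * k) (move-source φ u≢v) ⟩
        φ u ∸ 2 ∸ 2 * k           ≡⟨ ∸-+-assoc (φ u) 2 (2 * k) ⟩
        φ u ∸ (2 + 2 * k)         ≡⟨ cong (φ u ∸_) (sym (*-suc 2 k)) ⟩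
        φ u ∸ 2 * suc k           ∎
    ; at-target = begin
        ψ v                       ≡⟨ Transfer.at-target t ⟩
        move G φ u v v + k        ≡⟨ cong (_+ k) (move-target φ u≢v) ⟩
        suc (φ v) + k             ≡⟨ sym (+-suc (φ v) k) ⟩
        φ v + suc k               ∎
    ; elsewhere = λ w w≢u w≢v → trans (Transfer.elsewhere t w w≢u w≢v) (move-other φ w≢u w≢v) }
    where
    open ≡-Reasoning
    h′ : 2 * k + 2 ≤ φ u
    h′ = subst (_≤ φ u) (trans (*-suc 2 k) (+-comm 2 (2 * k))) h
    rest : Σ (Config G) λ ψ → Transfer r (move G φ u v) ψ u v k
    rest = transfer r (move G φ u v) k a u≢v
             (subst (2 * k ≤_) (sym (move-source φ u≢v)) (m+n≤o⇒m≤o∸n (2 * k) h′))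
    ψ : Config G
    ψ = proj₁ rest
    t : Transfer r (move G φ u v) ψ u v k
    t = proj₂ rest

  unsolvable-below : ∀ {r} φ → ¬ Solvable G r φ → ∀ k → k ≤ size G φ →
                     Σ (Config G) λ ψ → size G ψ ≡ k × ¬ Solvable G r ψ
  unsolvable-below φ unsolvable k k≤ with sumFin-split (order G) φ k k≤
  ... | ψ , ψ≤φ , size≡k = ψ , size≡k , unsolvable ∘ Solvable-mono ψ≤φ

  isRootedPebblingNumber : ∀ {r m} φ → ¬ Solvable G r φ → m ≡ suc (size G φ) →
                           (∀ ψ → size G ψ ≡ m → Solvable G r ψ) → IsRootedPebblingNumber G r m
  isRootedPebblingNumber φ unsolvable refl solvable =
    s≤s z≤n , solvable , λ k _ k<m → unsolvable-below φ unsolvable k (≤-pred k<m)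

  sparse-unsolvable : ∀ {r} φ → (∀ w → φ w ≤ 1) → φ r ≡ 0 → ¬ Solvable G r φ
  sparse-unsolvable φ ≤1 φr≡0 (done 1≤φr) = contradiction (subst (1 ≤_) φr≡0 1≤φr) λ ()
  sparse-unsolvable φ ≤1 φr≡0 (step u v a 2≤φu s) = contradiction (≤-trans 2≤φu (≤1 u)) λ { (s≤s ()) }

  ones-except : V → Config G
  ones-except r = updateAt (const 1) r (const 0)

  ones-except-unsolvable : ∀ r → ¬ Solvable G r (ones-except r)
  ones-except-unsolvable r = sparse-unsolvable (ones-except r) ≤1 (updateAt-updates r (const 1))
    where
    ≤1 : ∀ w → ones-except r w ≤ 1
    ≤1 w with w ≟ r
    ... | yes refl = subst (_≤ 1) (sym (updateAt-updates r (const 1))) z≤n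
    ... | no w≢r   = ≤-reflexive (updateAt-minimal w r (const 1) w≢r)

  order≡suc-size-ones-except : ∀ r → order G ≡ suc (size G (ones-except r))
  order≡suc-size-ones-except r = begin
    order G                                ≡⟨ *-identityʳ (order G) ⟨
    order G * 1                            ≡⟨ sumFin-const (order G) 1 ⟨
    sumFin (order G) (const 1)             ≡⟨ +-identityʳ _ ⟨
    sumFin (order G) (const 1) + 0         ≡⟨ sumFin-updateAt (order G) (const 1) r (const 0) ⟨
    size G (ones-except r) + 1             ≡⟨ +-comm _ 1 ⟩
    suc (size G (ones-except r))           ∎
    where open ≡-Reasoning

l≢opposite : ∀ (l : Fin 2) → l ≢ opposite l
l≢opposite zero ()
l≢opposite (suc zero) ()

level-cases : ∀ (ℓ l : Fin 2) → l ≡ ℓ ⊎ l ≡ opposite ℓ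
level-cases zero       zero       = inj₁ refl
level-cases zero       (suc zero) = inj₂ refl
level-cases (suc zero) zero       = inj₂ refl
level-cases (suc zero) (suc zero) = inj₁ refl

opposite-involutive : ∀ (l : Fin 2) → opposite (opposite l) ≡ l
opposite-involutive zero       = refl
opposite-involutive (suc zero) = refl

≢⇒opposite : ∀ {l l′ : Fin 2} → l ≢ l′ → l′ ≡ opposite l
≢⇒opposite {l} {l′} l≢l′ with level-cases l l′
... | inj₁ l′≡l = contradiction (sym l′≡l) l≢l′
... | inj₂ l′≡l̄ = l′≡l̄

module Book (n : ℕ) where

  B : Graph
  B = book n

  Vertex : Set
  Vertex = Fin (order B)

  -- Vertex (q , l) of K_{1,n} □ P_2: column q = 0 is the spine, level l ∈ P_2.
  vertex : Fin (suc n) → Fin 2 → Vertex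
  vertex = combine

  column : Vertex → Fin (suc n)
  column w = proj₁ (remQuot {suc n} 2 w)

  level : Vertex → Fin 2
  level w = proj₂ (remQuot {suc n} 2 w)

  vertex-column-level : ∀ w → vertex (column w) (level w) ≡ w
  vertex-column-level = combine-remQuot {suc n} 2

  vertex-injective : ∀ {q l q′ l′} → vertex q l ≡ vertex q′ l′ → q ≡ q′ × l ≡ l′
  vertex-injective {q} {l} {q′} {l′} = combine-injective q l q′ l′

  vertex-≢ʳ : ∀ {q q′} l l′ → q ≢ q′ → vertex q l ≢ vertex q′ l′
  vertex-≢ʳ {q} {q′} l l′ q≢q′ eq = q≢q′ (proj₁ (vertex-injective {q} {l} {q′} {l′} eq))

  vertex-≢ˡ : ∀ {l l′} q q′ → l ≢ l′ → vertex q l ≢ vertex q′ l′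
  vertex-≢ˡ {l} {l′} q q′ l≢l′ eq = l≢l′ (proj₂ (vertex-injective {q} {l} {q′} {l′} eq))

  SpokeOrRung : Fin (suc n) → Fin 2 → Fin (suc n) → Fin 2 → Set
  SpokeOrRung q l q′ l′ = (Adj (star n) q q′ × l ≡ l′) ⊎ (q ≡ q′ × l ≢ l′)

  adjacent : ∀ {q l q′ l′} → SpokeOrRung q l q′ l′ → Adj B (vertex q l) (vertex q′ l′)
  adjacent {q} {l} {q′} {l′} =
    subst₂ (λ x y → SpokeOrRung (proj₁ x) (proj₂ x) (proj₁ y) (proj₂ y))
           (sym (remQuot-combine q l)) (sym (remQuot-combine q′ l′))

  adjacent⁻¹ : ∀ {q l q′ l′} → Adj B (vertex q l) (vertex q′ l′) → SpokeOrRung q l q′ l′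
  adjacent⁻¹ {q} {l} {q′} {l′} =
    subst₂ (λ x y → SpokeOrRung (proj₁ x) (proj₂ x) (proj₁ y) (proj₂ y))
           (remQuot-combine q l) (remQuot-combine q′ l′)

  edge-coordinates : ∀ (P : Vertex → Vertex → Set) →
    (∀ {qu lu qv lv} → SpokeOrRung qu lu qv lv → P (vertex qu lu) (vertex qv lv)) →
    ∀ {u v} → Adj B u v → P u v
  edge-coordinates P P-edge {u} {v} u~v =
    subst₂ P (vertex-column-level u) (vertex-column-level v)
      (P-edge (adjacent⁻¹ {column u} {level u} {column v} {level v}
        (subst₂ (Adj B) (sym (vertex-column-level u)) (sym (vertex-column-level v)) u~v)))

  spoke-out : ∀ {q} l → q ≢ zero → Adj B (vertex zero l) (vertex q l)
  spoke-out {q} l q≢0 = adjacent {zero} {l} {q} {l} (inj₁ (inj₁ (refl , q≢0) , refl))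

  spoke-in : ∀ {q} l → q ≢ zero → Adj B (vertex q l) (vertex zero l)
  spoke-in {q} l q≢0 = adjacent {q} {l} {zero} {l} (inj₁ (inj₂ (q≢0 , refl) , refl))

  rung : ∀ q {l l′} → l ≢ l′ → Adj B (vertex q l) (vertex q l′)
  rung q {l} {l′} l≢l′ = adjacent {q} {l} {q} {l′} (inj₂ (refl , l≢l′))

  colSum : Config B → Fin (suc n) → ℕ
  colSum φ q = φ (vertex q zero) + φ (vertex q (suc zero))

  colSum-level : ∀ φ q ℓ → colSum φ q ≡ φ (vertex q ℓ) + φ (vertex q (opposite ℓ))
  colSum-level φ q zero       = refl
  colSum-level φ q (suc zero) = +-comm (φ (vertex q zero)) (φ (vertex q (suc zero)))

  size-columns : ∀ φ → size B φ ≡ sumFin (suc n) (colSum φ)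
  size-columns = go (suc n)
    where
    go : ∀ m (φ : Fin (m * 2) → ℕ) →
         sumFin (m * 2) φ ≡ sumFin m (λ q → φ (combine q zero) + φ (combine q (suc zero)))
    go zero    φ = refl
    go (suc m) φ = trans (sym (+-assoc (φ zero) (φ (suc zero)) _))
                         (cong (φ zero + φ (suc zero) +_) (go m (λ i → φ (suc (suc i)))))

-- Column weights

-- R a b weighs a column holding a pebbles on the level of a move and b on the other level,
-- when the spine vertex on the level of the move is worth u.
record ColumnWeight (u : ℕ) (R : ℕ → ℕ → ℕ) : Set where
  field
    send    : ∀ a b → R a b + u ≤ R (2 + a) b
    receive : ∀ a b → R (suc a) b ≤ R a b + 2 * u
    shift   : ∀ a b → R a (suc b) ≤ R (2 + a) b

linear : ℕ → ℕ → ℕ → ℕ → ℕ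
linear c d a b = c * a + d * b

linear-weight : ∀ {u c d} → u ≤ 2 * c → c ≤ 2 * u → d ≤ 2 * c → ColumnWeight u (linear c d)
linear-weight {u} {c} {d} u≤2c c≤2u d≤2c = record
  { send = λ a b → begin
      c * a + d * b + u           ≤⟨ +-monoʳ-≤ (c * a + d * b) u≤2c ⟩
      c * a + d * b + 2 * c       ≡⟨ two-more c d a b ⟩
      c * (2 + a) + d * b         ∎
  ; receive = λ a b → begin
      c * suc a + d * b           ≡⟨ one-more c d a b ⟩
      c * a + d * b + c           ≤⟨ +-monoʳ-≤ (c * a + d * b) c≤2u ⟩
      c * a + d * b + 2 * u       ∎
  ; shift = λ a b → begin
      c * a + d * suc b           ≡⟨ one-moreʳ c d a b ⟩
      c * a + d * b + d           ≤⟨ +-monoʳ-≤ (c * a + d * b) d≤2c ⟩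
      c * a + d * b + 2 * c       ≡⟨ two-more c d a b ⟩
      c * (2 + a) + d * b         ∎ }
  where
  open ≤-Reasoning
  two-more : ∀ c d a b → c * a + d * b + 2 * c ≡ c * (2 + a) + d * b
  two-more = solve-∀
  one-more : ∀ c d a b → c * suc a + d * b ≡ c * a + d * b + c
  one-more = solve-∀
  one-moreʳ : ∀ c d a b → c * a + d * suc b ≡ c * a + d * b + d
  one-moreʳ = solve-∀

-- Twice the largest number of pebbles, counted 2 on the root's level and 1 on the other,
-- that a column holding a pebbles on the root's level and b on the other can put on the spine.
columnWeight : ℕ → ℕ → ℕ
columnWeight (suc (suc a)) b             = 4 + columnWeight a b
columnWeight (suc zero)    (suc (suc b)) = 4 + columnWeight zero b
columnWeight (suc zero)    _             = 0
columnWeight zero          (suc (suc b)) = 2 + columnWeight zero b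
columnWeight zero          _             = 0

private
  columnWeight-0-suc : ∀ b → columnWeight 0 (suc b) ≤ 2 + columnWeight 0 b
  columnWeight-0-suc zero          = z≤n
  columnWeight-0-suc (suc zero)    = ≤-refl
  columnWeight-0-suc (suc (suc b)) = +-monoʳ-≤ 2 (columnWeight-0-suc b)

  columnWeight-1≤0 : ∀ b → columnWeight 1 b ≤ 2 + columnWeight 0 b
  columnWeight-1≤0 zero          = z≤n
  columnWeight-1≤0 (suc zero)    = z≤n
  columnWeight-1≤0 (suc (suc b)) = ≤-refl

  columnWeight-0≤1 : ∀ b → columnWeight 0 b ≤ 2 + columnWeight 1 b
  columnWeight-0≤1 zero          = z≤n
  columnWeight-0≤1 (suc zero)    = z≤n
  columnWeight-0≤1 (suc (suc b)) = +-monoʳ-≤ 2 (m≤n+m (columnWeight 0 b) 4)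

  columnWeight-suc-right : ∀ a b → columnWeight a (suc b) ≤ 4 + columnWeight a b
  columnWeight-suc-right (suc (suc a)) b             = +-monoʳ-≤ 4 (columnWeight-suc-right a b)
  columnWeight-suc-right (suc zero)    zero          = z≤n
  columnWeight-suc-right (suc zero)    (suc zero)    = ≤-refl
  columnWeight-suc-right (suc zero)    (suc (suc b)) =
    +-monoʳ-≤ 4 (≤-trans (columnWeight-0-suc b) (+-monoˡ-≤ (columnWeight 0 b) (s≤s (s≤s z≤n))))
  columnWeight-suc-right zero          b             =
    ≤-trans (columnWeight-0-suc b) (+-monoˡ-≤ (columnWeight 0 b) (s≤s (s≤s z≤n)))

  columnWeight-suc-left : ∀ a b → columnWeight (suc a) b ≤ 8 + columnWeight a b
  columnWeight-suc-left (suc (suc a)) b             = +-monoʳ-≤ 4 (columnWeight-suc-left a b)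
  columnWeight-suc-left (suc zero)    b             =
    +-monoʳ-≤ 4 (≤-trans (columnWeight-0≤1 b) (+-monoˡ-≤ (columnWeight 1 b) (s≤s (s≤s z≤n))))
  columnWeight-suc-left zero          b             =
    ≤-trans (columnWeight-1≤0 b) (+-monoˡ-≤ (columnWeight 0 b) (s≤s (s≤s z≤n)))

columnWeight-top : ColumnWeight 4 columnWeight
columnWeight-top = record
  { send    = λ a b → ≤-reflexive (+-comm (columnWeight a b) 4)
  ; receive = λ a b → ≤-trans (columnWeight-suc-left a b) (≤-reflexive (+-comm 8 _))
  ; shift   = columnWeight-suc-right }

columnWeight-bottom : ColumnWeight 2 (λ a b → columnWeight b a)
columnWeight-bottom = record
  { send    = send
  ; receive = λ a b → ≤-trans (columnWeight-suc-right b a) (≤-reflexive (+-comm 4 _))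
  ; shift   = shift }
  where
  send : ∀ a b → columnWeight b a + 2 ≤ columnWeight b (2 + a)
  send a (suc (suc b)) = ≤-trans (≤-reflexive (+-assoc 4 _ 2)) (+-monoʳ-≤ 4 (send a b))
  send a (suc zero)    =
    ≤-trans (+-monoˡ-≤ 2 (columnWeight-1≤0 a)) (≤-reflexive (+-comm (2 + columnWeight 0 a) 2))
  send a zero          = ≤-reflexive (+-comm (columnWeight 0 a) 2)
  shift : ∀ a b → columnWeight (suc b) a ≤ columnWeight b (2 + a)
  shift a (suc (suc b)) = +-monoʳ-≤ 4 (shift a b)
  shift a (suc zero)    = ≤-refl
  shift a zero          = columnWeight-1≤0 a

ColumnWeight-cong : ∀ {u R R′} → (∀ a b → R a b ≡ R′ a b) → ColumnWeight u R → ColumnWeight u R′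
ColumnWeight-cong {u} {R} {R′} R≗R′ w = record
  { send    = λ a b → subst₂ _≤_ (cong (_+ u) (R≗R′ a b)) (R≗R′ (2 + a) b) (send a b)
  ; receive = λ a b → subst₂ _≤_ (R≗R′ (suc a) b) (cong (_+ 2 * u) (R≗R′ a b)) (receive a b)
  ; shift   = λ a b → subst₂ _≤_ (R≗R′ a (suc b)) (R≗R′ (2 + a) b) (shift a b) }
  where open ColumnWeight w

-- Draining ordinary columns into the spine

2*⌊n/2⌋≤n : ∀ n → 2 * ⌊ n /2⌋ ≤ n
2*⌊n/2⌋≤n zero          = z≤n
2*⌊n/2⌋≤n (suc zero)    = z≤n
2*⌊n/2⌋≤n (suc (suc n)) = subst (_≤ 2 + n) (sym (*-suc 2 ⌊ n /2⌋)) (+-monoʳ-≤ 2 (2*⌊n/2⌋≤n n))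

2+m≤n⇒m≤n∸2 : ∀ {m n} → 2 + m ≤ n → m ≤ n ∸ 2
2+m≤n⇒m≤n∸2 {m} {n} le = m+n≤o⇒m≤o∸n m (subst (_≤ n) (+-comm 2 m) le)

≤-split : ∀ a b {c} → c ≤ a + b → Σ ℕ λ a′ → Σ ℕ λ b′ → a′ ≤ a × b′ ≤ b × a′ + b′ ≡ c
≤-split a b {c} c≤a+b with c ≤? b
... | yes c≤b = 0 , c , z≤n , c≤b , refl
... | no c≰b  = c ∸ b , b , m≤n+o⇒m∸n≤o c b (subst (c ≤_) (+-comm a b) c≤a+b) , ≤-refl , m∸n+n≡m (≰⇒≥ c≰b)

budget-skip : ∀ {k D c R} → 2 * suc k + D ≤ c + R → c ≤ 2 → 2 * k + D ≤ R
budget-skip {k} {D} {c} {R} enough c≤2 =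
  +-cancelˡ-≤ 2 (2 * k + D) R (≤-trans (subst (_≤ c + R) (rearrange k D) enough) (+-monoˡ-≤ R c≤2))
  where
  rearrange : ∀ k D → 2 * suc k + D ≡ 2 + (2 * k + D)
  rearrange = solve-∀

budget-drain : ∀ {k D D′ c R} → 2 * suc k + D ≤ c + R → D′ + c ≤ D + 2 → 2 * k + D′ ≤ R
budget-drain {k} {D} {D′} {c} {R} enough D′+c≤ = +-cancelʳ-≤ c (2 * k + D′) R (begin
  2 * k + D′ + c        ≡⟨ +-assoc (2 * k) D′ c ⟩
  2 * k + (D′ + c)      ≤⟨ +-monoʳ-≤ (2 * k) D′+c≤ ⟩
  2 * k + (D + 2)       ≡⟨ rearrange k D ⟩
  2 * suc k + D         ≤⟨ enough ⟩
  c + R                 ≡⟨ +-comm c R ⟩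
  R + c                 ∎)
  where
  open ≤-Reasoning
  rearrange : ∀ k D → 2 * k + (D + 2) ≡ 2 * suc k + D
  rearrange = solve-∀

-- δ dx dy is the deficiency once the spine has gained dx and dy pebbles; a column of
-- c pebbles must lower it by c - 2.
Improves : (ℕ → ℕ → ℕ) → ℕ → ℕ → ℕ → Set
Improves δ c dx dy = δ dx dy + c ≤ δ 0 0 + 2

-- The column (a , b) improves δ by sending its pebbles straight to the spine, or after first
-- moving one pebble up or down the column.
Deliverable : (ℕ → ℕ → ℕ) → ℕ → ℕ → Set
Deliverable δ a b = Improves δ (a + b) ⌊ a /2⌋ ⌊ b /2⌋
                  ⊎ 2 ≤ b × Improves δ (a + b) ⌊ suc a /2⌋ ⌊ b ∸ 2 /2⌋
                  ⊎ 2 ≤ a × Improves δ (a + b) ⌊ a ∸ 2 /2⌋ ⌊ suc b /2⌋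

module Deliveries (n : ℕ) (ℓ : Fin 2) (r : Fin (order (book n))) where

  open Book n

  private
    ℓ̄ : Fin 2
    ℓ̄ = opposite ℓ

  record Delivery (φ ψ : Config B) (q : Fin (suc n)) (dx dy : ℕ) : Set where
    field
      solvable     : Solvable B r ψ → Solvable B r φ
      spine-top    : ψ (vertex zero ℓ) ≡ φ (vertex zero ℓ) + dx
      spine-bottom : ψ (vertex zero ℓ̄) ≡ φ (vertex zero ℓ̄) + dy
      elsewhere    : ∀ q′ l → q′ ≢ zero → q′ ≢ q → ψ (vertex q′ l) ≡ φ (vertex q′ l)

  module _ {q : Fin (suc n)} (q≢0 : q ≢ zero) where

    private
      ℓ≢ℓ̄ : ℓ ≢ ℓ̄
      ℓ≢ℓ̄ = l≢opposite ℓ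
      0≢q : zero ≢ q
      0≢q = q≢0 ∘ sym

    deliver : ∀ φ a b → a ≤ φ (vertex q ℓ) → b ≤ φ (vertex q ℓ̄) →
              Σ (Config B) λ ψ → Delivery φ ψ q ⌊ a /2⌋ ⌊ b /2⌋
    deliver φ a b a≤ b≤ = ψ₂ , record
      { solvable     = Transfer.solvable t₁ ∘ Transfer.solvable t₂
      ; spine-top    = trans (Transfer.elsewhere t₂ _ (vertex-≢ʳ ℓ ℓ̄ 0≢q) (vertex-≢ˡ zero zero ℓ≢ℓ̄))
                             (Transfer.at-target t₁)
      ; spine-bottom = trans (Transfer.at-target t₂)
                             (cong (_+ ⌊ b /2⌋) (Transfer.elsewhere t₁ _ (vertex-≢ʳ ℓ̄ ℓ 0≢q)
                                                                          (vertex-≢ˡ zero zero (ℓ≢ℓ̄ ∘ sym))))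
      ; elsewhere    = λ q′ l q′≢0 q′≢q →
          trans (Transfer.elsewhere t₂ _ (vertex-≢ʳ l ℓ̄ q′≢q) (vertex-≢ʳ l ℓ̄ q′≢0))
                (Transfer.elsewhere t₁ _ (vertex-≢ʳ l ℓ q′≢q) (vertex-≢ʳ l ℓ q′≢0)) }
      where
      step₁ : Σ (Config B) λ ψ → Transfer r φ ψ (vertex q ℓ) (vertex zero ℓ) ⌊ a /2⌋
      step₁ = transfer r φ ⌊ a /2⌋ (spoke-in ℓ q≢0) (vertex-≢ʳ ℓ ℓ q≢0) (≤-trans (2*⌊n/2⌋≤n a) a≤)
      ψ₁ : Config B
      ψ₁ = proj₁ step₁
      t₁ : Transfer r φ ψ₁ (vertex q ℓ) (vertex zero ℓ) ⌊ a /2⌋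
      t₁ = proj₂ step₁
      b≤ψ₁ : b ≤ ψ₁ (vertex q ℓ̄)
      b≤ψ₁ = subst (b ≤_) (sym (Transfer.elsewhere t₁ _ (vertex-≢ˡ q q (ℓ≢ℓ̄ ∘ sym)) (vertex-≢ʳ ℓ̄ ℓ q≢0))) b≤
      step₂ : Σ (Config B) λ ψ → Transfer r ψ₁ ψ (vertex q ℓ̄) (vertex zero ℓ̄) ⌊ b /2⌋
      step₂ = transfer r ψ₁ ⌊ b /2⌋ (spoke-in ℓ̄ q≢0) (vertex-≢ʳ ℓ̄ ℓ̄ q≢0) (≤-trans (2*⌊n/2⌋≤n b) b≤ψ₁)
      ψ₂ : Config B
      ψ₂ = proj₁ step₂
      t₂ : Transfer r ψ₁ ψ₂ (vertex q ℓ̄) (vertex zero ℓ̄) ⌊ b /2⌋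
      t₂ = proj₂ step₂

    delivery-after-shift : ∀ {φ ψ₀ ψ l l′ dx dy} → Transfer r φ ψ₀ (vertex q l) (vertex q l′) 1 →
                           Delivery ψ₀ ψ q dx dy → Delivery φ ψ q dx dy
    delivery-after-shift {φ} {ψ₀} {l = l} {l′} {dx} {dy} t d = record
      { solvable     = Transfer.solvable t ∘ Delivery.solvable d
      ; spine-top    = trans (Delivery.spine-top d) (cong (_+ dx) (unchanged ℓ))
      ; spine-bottom = trans (Delivery.spine-bottom d) (cong (_+ dy) (unchanged ℓ̄))
      ; elsewhere    = λ q′ l″ q′≢0 q′≢q →
          trans (Delivery.elsewhere d q′ l″ q′≢0 q′≢q)
                (Transfer.elsewhere t _ (vertex-≢ʳ l″ l q′≢q) (vertex-≢ʳ l″ l′ q′≢q)) }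
      where
      unchanged : ∀ l″ → ψ₀ (vertex zero l″) ≡ φ (vertex zero l″)
      unchanged l″ = Transfer.elsewhere t (vertex zero l″) (vertex-≢ʳ l″ l 0≢q) (vertex-≢ʳ l″ l′ 0≢q)

    deliver-up : ∀ φ a b → a ≤ φ (vertex q ℓ) → 2 + b ≤ φ (vertex q ℓ̄) →
                 Σ (Config B) λ ψ → Delivery φ ψ q ⌊ suc a /2⌋ ⌊ b /2⌋
    deliver-up φ a b a≤ 2+b≤
      with transfer r φ 1 (rung q (ℓ≢ℓ̄ ∘ sym)) (vertex-≢ˡ q q (ℓ≢ℓ̄ ∘ sym)) (≤-trans (m≤m+n 2 b) 2+b≤)
    ... | ψ₀ , t with deliver ψ₀ (suc a) b
                        (subst (suc a ≤_) (sym (trans (Transfer.at-target t) (+-comm _ 1))) (s≤s a≤))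
                        (subst (b ≤_) (sym (Transfer.at-source t)) (2+m≤n⇒m≤n∸2 2+b≤))
    ...   | ψ , d = ψ , delivery-after-shift t d

    deliver-down : ∀ φ a b → 2 + a ≤ φ (vertex q ℓ) → b ≤ φ (vertex q ℓ̄) →
                   Σ (Config B) λ ψ → Delivery φ ψ q ⌊ a /2⌋ ⌊ suc b /2⌋
    deliver-down φ a b 2+a≤ b≤
      with transfer r φ 1 (rung q ℓ≢ℓ̄) (vertex-≢ˡ q q ℓ≢ℓ̄) (≤-trans (m≤m+n 2 a) 2+a≤)
    ... | ψ₀ , t with deliver ψ₀ a (suc b)
                        (subst (a ≤_) (sym (Transfer.at-source t)) (2+m≤n⇒m≤n∸2 2+a≤))
                        (subst (suc b ≤_) (sym (trans (Transfer.at-target t) (+-comm _ 1))) (s≤s b≤))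
    ...   | ψ , d = ψ , delivery-after-shift t d

  module ColumnInduction
    (Ordinary    : Fin (suc n) → Set)
    (ordinary≢0  : ∀ {q} → Ordinary q → q ≢ zero)
    (core        : Config B → ℕ → ℕ → ℕ)
    (core-moves  : ∀ {φ ψ q dx dy} → Ordinary q → Delivery φ ψ q dx dy → core ψ 0 0 ≡ core φ dx dy)
    (vanishing   : ∀ φ → core φ 0 0 ≡ 0 → Solvable B r φ)
    (deliverable : ∀ φ → 0 < core φ 0 0 → ∀ a b → 3 ≤ a + b → a + b ≤ core φ 0 0 + 2 →
                   Deliverable (core φ) a b)
    where

    deficiency : Config B → ℕ
    deficiency φ = core φ 0 0

    Delivered : Config B → Config B → Fin (suc n) → Set
    Delivered φ ψ q = Σ ℕ λ dx → Σ ℕ λ dy → Delivery φ ψ q dx dy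

    record Drained (φ ψ : Config B) (q : Fin (suc n)) : Set where
      field
        solvable : Solvable B r ψ → Solvable B r φ
        progress : deficiency ψ + colSum φ q ≤ deficiency φ + 2 ⊎ deficiency ψ ≡ 0
        keeps    : ∀ q′ → q′ ≢ zero → q′ ≢ q → colSum ψ q′ ≡ colSum φ q′

    drained : ∀ {φ ψ q} → Delivered φ ψ q →
              deficiency ψ + colSum φ q ≤ deficiency φ + 2 ⊎ deficiency ψ ≡ 0 → Drained φ ψ q
    drained (_ , _ , d) progress = record
      { solvable = Delivery.solvable d
      ; progress = progress
      ; keeps    = λ q′ q′≢0 q′≢q → cong₂ _+_ (Delivery.elsewhere d q′ zero q′≢0 q′≢q)
                                               (Delivery.elsewhere d q′ (suc zero) q′≢0 q′≢q) }

    private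
      module Drain (φ : Config B) (q : Fin (suc n)) (ord : Ordinary q) where
        a b : ℕ
        a = φ (vertex q ℓ)
        b = φ (vertex q ℓ̄)

        c≡a+b : colSum φ q ≡ a + b
        c≡a+b = colSum-level φ q ℓ

        improved : ∀ {ψ dx dy c} → Delivery φ ψ q dx dy → Improves (core φ) c dx dy →
                   deficiency ψ + c ≤ deficiency φ + 2
        improved {c = c} d imp = subst (λ x → x + c ≤ deficiency φ + 2) (sym (core-moves ord d)) imp

        realise : ∀ {a′ b′} → Deliverable (core φ) a′ b′ → a′ ≤ a → b′ ≤ b →
                  Σ (Config B) λ ψ → Delivered φ ψ q × deficiency ψ + (a′ + b′) ≤ deficiency φ + 2
        realise {a′} {b′} (inj₁ imp) a′≤a b′≤b with deliver (ordinary≢0 ord) φ a′ b′ a′≤a b′≤b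
        ... | ψ , d = ψ , (_ , _ , d) , improved d imp
        realise {a′} {b′} (inj₂ (inj₁ (2≤b′ , imp))) a′≤a b′≤b
          with deliver-up (ordinary≢0 ord) φ a′ (b′ ∸ 2) a′≤a (subst (_≤ b) (sym (m+[n∸m]≡n 2≤b′)) b′≤b)
        ... | ψ , d = ψ , (_ , _ , d) , improved d imp
        realise {a′} {b′} (inj₂ (inj₂ (2≤a′ , imp))) a′≤a b′≤b
          with deliver-down (ordinary≢0 ord) φ (a′ ∸ 2) b′ (subst (_≤ a) (sym (m+[n∸m]≡n 2≤a′)) a′≤a) b′≤b
        ... | ψ , d = ψ , (_ , _ , d) , improved d imp

        -- A column of more than deficiency φ + 2 pebbles is drained through a part of exactly that size.
        result : 0 < deficiency φ → 3 ≤ colSum φ q → Σ (Config B) λ ψ → Drained φ ψ q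
        result 0<D 3≤c with colSum φ q ≤? deficiency φ + 2
        ... | yes c≤ with realise (deliverable φ 0<D a b (subst (3 ≤_) c≡a+b 3≤c) (subst (_≤ deficiency φ + 2) c≡a+b c≤))
                                  ≤-refl ≤-refl
        ...   | ψ , d , improves =
          ψ , drained d (inj₁ (subst (λ c → deficiency ψ + c ≤ deficiency φ + 2) (sym c≡a+b) improves))
        result 0<D 3≤c | no c≰ with ≤-split a b (subst (deficiency φ + 2 ≤_) c≡a+b (≰⇒≥ c≰))
        ... | a′ , b′ , a′≤a , b′≤b , a′+b′≡D+2
          with realise (deliverable φ 0<D a′ b′ (subst (3 ≤_) (sym a′+b′≡D+2) (+-monoˡ-≤ 2 0<D))
                                                (≤-reflexive a′+b′≡D+2)) a′≤a b′≤b
        ...   | ψ , d , improves =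
          ψ , drained d (inj₂ (n≤0⇒n≡0 (+-cancelʳ-≤ (deficiency φ + 2) (deficiency ψ) 0
                 (subst (λ c → deficiency ψ + c ≤ deficiency φ + 2) a′+b′≡D+2 improves))))

    drain : ∀ φ q → Ordinary q → 0 < deficiency φ → 3 ≤ colSum φ q → Σ (Config B) λ ψ → Drained φ ψ q
    drain = Drain.result

    -- Draining the columns t 0, t 1, … one at a time keeps 2 k + deficiency ≤ Σ colSum, since a
    -- column of at most two pebbles can be skipped and a larger one lowers the deficiency enough.
    solvable-by-columns : ∀ k (t : Fin k → Fin (suc n)) → Injective _≡_ _≡_ t → (∀ i → Ordinary (t i)) →
                          ∀ φ → 2 * k + deficiency φ ≤ sumFin k (colSum φ ∘ t) → Solvable B r φ
    solvable-by-columns k t t-inj ord φ enough with deficiency φ Nat.≟ 0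
    ... | yes D≡0 = vanishing φ D≡0
    solvable-by-columns zero t t-inj ord φ enough | no D≢0 = contradiction (n≤0⇒n≡0 enough) D≢0
    solvable-by-columns (suc k) t t-inj ord φ enough | no D≢0 with colSum φ (t zero) ≤? 2
    ... | yes c≤2 = solvable-by-columns k (t ∘ suc) (suc-injective ∘ t-inj) (ord ∘ suc) φ
                      (budget-skip {k} {deficiency φ} enough c≤2)
    ... | no c≰2 with drain φ (t zero) (ord zero) (n≢0⇒n>0 D≢0) (≰⇒> c≰2)
    ...   | ψ , dr with Drained.progress dr
    ...     | inj₂ Dψ≡0 = Drained.solvable dr (vanishing ψ Dψ≡0)
    ...     | inj₁ le   = Drained.solvable dr
                            (solvable-by-columns k (t ∘ suc) (suc-injective ∘ t-inj) (ord ∘ suc) ψ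
                              (subst (2 * k + deficiency ψ ≤_) (sym rest-kept)
                                     (budget-drain {k} {deficiency φ} enough le)))
      where
      rest-kept : sumFin k (colSum ψ ∘ t ∘ suc) ≡ sumFin k (colSum φ ∘ t ∘ suc)
      rest-kept = sumFin-cong k λ i →
        Drained.keeps dr (t (suc i)) (ordinary≢0 (ord (suc i))) (λ eq → contradiction (t-inj eq) λ ())

∀-< : ∀ {k} {P : ℕ → Set} → (∀ (i : Fin k) → P (toℕ i)) → ∀ {x} → x < k → P x
∀-< {P = P} P-all x<k = subst P (toℕ-fromℕ< x<k) (P-all (fromℕ< x<k))

deliverable? : ∀ δ a b → Dec (Deliverable δ a b)
deliverable? δ a b = improves? _ _ ⊎-dec (2 ≤? b ×-dec improves? _ _) ⊎-dec (2 ≤? a ×-dec improves? _ _)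
  where
  improves? : ∀ dx dy → Dec (Improves δ (a + b) dx dy)
  improves? dx dy = δ dx dy + (a + b) ≤? δ 0 0 + 2

-- Quantified over Fin so that all? decides it.
AllDeliverable : (ℕ → ℕ → ℕ) → Set
AllDeliverable δ = ∀ (a b : Fin (suc (δ 0 0 + 2))) → 3 ≤ toℕ a + toℕ b → toℕ a + toℕ b ≤ δ 0 0 + 2 →
                   Deliverable δ (toℕ a) (toℕ b)

allDeliverable? : ∀ δ → Dec (AllDeliverable δ)
allDeliverable? δ = all? λ a → all? λ b → 3 ≤? _ →-dec _ ≤? _ →-dec deliverable? δ (toℕ a) (toℕ b)

allDeliverable⇒deliverable : ∀ δ → AllDeliverable δ → ∀ a b → 3 ≤ a + b → a + b ≤ δ 0 0 + 2 → Deliverable δ a b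
allDeliverable⇒deliverable δ all a b 3≤ ≤D+2 =
  ∀-< {P = λ a → 3 ≤ a + b → a + b ≤ δ 0 0 + 2 → Deliverable δ a b}
    (λ a′ → ∀-< {P = λ b → 3 ≤ toℕ a′ + b → toℕ a′ + b ≤ δ 0 0 + 2 → Deliverable δ (toℕ a′) b} (all a′) b<)
    a< 3≤ ≤D+2
  where
  a< : a < suc (δ 0 0 + 2)
  a< = s≤s (≤-trans (m≤m+n a b) ≤D+2)
  b< : b < suc (δ 0 0 + 2)
  b< = s≤s (≤-trans (m≤n+m b a) ≤D+2)

-- A leaf root r on level ℓ of column j: x, y are the pebbles on the spine vertices of
-- levels ℓ and ℓ̄, z those on the other vertex of column j. Hub x y z says that these
-- three vertices alone reach r when r is empty.
Hub : ℕ → ℕ → ℕ → Set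
Hub x y z = 2 ≤ x ⊎ 2 ≤ z ⊎ 4 ≤ y ⊎ 2 ≤ y × (1 ≤ x ⊎ 1 ≤ z)

hub? : ∀ x y z → Dec (Hub x y z)
hub? x y z = 2 ≤? x ⊎-dec 2 ≤? z ⊎-dec 4 ≤? y ⊎-dec 2 ≤? y ×-dec (1 ≤? x ⊎-dec 1 ≤? z)

-- Together with x, y and z, shortfall x y z + 2 pebbles on one ordinary column reach r.
shortfall : ℕ → ℕ → ℕ → ℕ
shortfall 0 0 0 = 6
shortfall 0 0 1 = 4
shortfall 0 1 0 = 4
shortfall 0 1 1 = 2
shortfall 0 2 0 = 2
shortfall 0 3 0 = 1
shortfall 1 0 0 = 2
shortfall 1 0 1 = 2
shortfall 1 1 0 = 1
shortfall 1 1 1 = 1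
shortfall _ _ _ = 0

leafDeficiency : ℕ → ℕ → ℕ → ℕ
leafDeficiency x y z = if does (hub? x y z) then 0 else shortfall x y z

leafCore : ℕ → ℕ → ℕ → ℕ → ℕ → ℕ
leafCore x y z dx dy = leafDeficiency (dx + x) (dy + y) z

LeafInterior : ℕ → ℕ → ℕ → Set
LeafInterior x y z =
  0 < leafDeficiency x y z × leafDeficiency x y z + (x + (y + z)) ≤ 6 × AllDeliverable (leafCore x y z)

leafCase? : ∀ x y z → Dec (Hub x y z ⊎ LeafInterior x y z)
leafCase? x y z = hub? x y z ⊎-dec (0 <? leafDeficiency x y z ×-dec leafDeficiency x y z + (x + (y + z)) ≤? 6
                                    ×-dec allDeliverable? (leafCore x y z))

leaf-check : ∀ (x : Fin 2) (y : Fin 4) (z : Fin 2) →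
             Hub (toℕ x) (toℕ y) (toℕ z) ⊎ LeafInterior (toℕ x) (toℕ y) (toℕ z)
leaf-check =
  from-yes (all? λ (x : Fin 2) → all? λ (y : Fin 4) → all? λ (z : Fin 2) → leafCase? (toℕ x) (toℕ y) (toℕ z))

hub⇒leafDeficiency≡0 : ∀ {x y z} → Hub x y z → leafDeficiency x y z ≡ 0
hub⇒leafDeficiency≡0 {x} {y} {z} h = cong (if_then 0 else shortfall x y z) (dec-true (hub? x y z) h)

¬hub⇒bounded : ∀ {x y z} → ¬ Hub x y z → x < 2 × y < 4 × z < 2
¬hub⇒bounded {x} {y} {z} ¬h =
  bound (x <? 2) (inj₁ ∘ ≮⇒≥) , bound (y <? 4) (inj₂ ∘ inj₂ ∘ inj₁ ∘ ≮⇒≥) , bound (z <? 2) (inj₂ ∘ inj₁ ∘ ≮⇒≥)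
  where
  bound : ∀ {P : Set} → Dec P → (¬ P → Hub x y z) → P
  bound (yes p) _   = p
  bound (no ¬p) hub = contradiction (hub ¬p) ¬h

leaf-cases : ∀ x y z → Hub x y z ⊎ LeafInterior x y z
leaf-cases x y z with hub? x y z
... | yes h = inj₁ h
... | no ¬h with ¬hub⇒bounded ¬h
...   | x<2 , y<4 , z<2 =
  ∀-< {P = λ x → Hub x y z ⊎ LeafInterior x y z}
      (λ x′ → ∀-< {P = λ y → Hub (toℕ x′) y z ⊎ LeafInterior (toℕ x′) y z}
        (λ y′ → ∀-< {P = λ z → Hub (toℕ x′) (toℕ y′) z ⊎ LeafInterior (toℕ x′) (toℕ y′) z}
          (leaf-check x′ y′) z<2) y<4) x<2

leaf-vanishes : ∀ x y z → leafDeficiency x y z ≡ 0 → Hub x y z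
leaf-vanishes x y z D≡0 with leaf-cases x y z
... | inj₁ h         = h
... | inj₂ (0<D , _) = contradiction D≡0 (>⇒≢ 0<D)

leaf-interior : ∀ x y z → 0 < leafDeficiency x y z → LeafInterior x y z
leaf-interior x y z 0<D with leaf-cases x y z
... | inj₁ h        = contradiction (hub⇒leafDeficiency≡0 h) (>⇒≢ 0<D)
... | inj₂ interior = interior

-- A spine root r on level ℓ: x pebbles on r, y on the other spine vertex.
spineDeficiency : ℕ → ℕ → ℕ
spineDeficiency zero    y = 2 ∸ y
spineDeficiency (suc x) y = 0

spineCore : ℕ → ℕ → ℕ → ℕ → ℕ
spineCore x y dx dy = spineDeficiency (dx + x) (dy + y)

spine-check : ∀ (y : Fin 2) → AllDeliverable (spineCore 0 (toℕ y))
spine-check = from-yes (all? λ (y : Fin 2) → allDeliverable? (spineCore 0 (toℕ y)))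

spine-vanishes : ∀ x y → spineDeficiency x y ≡ 0 → 1 ≤ x ⊎ 2 ≤ y
spine-vanishes zero    y D≡0 = inj₂ (m∸n≡0⇒m≤n D≡0)
spine-vanishes (suc x) y _   = inj₁ (s≤s z≤n)

spine-interior : ∀ x y → 0 < spineDeficiency x y → x ≡ 0 × y < 2 × AllDeliverable (spineCore x y)
spine-interior zero y 0<D = refl , y<2 , ∀-< {P = AllDeliverable ∘ spineCore 0} spine-check y<2
  where
  y<2 : y < 2
  y<2 = m∸n≢0⇒n<m (>⇒≢ 0<D)

-- Spine roots

module SpineRoot (n : ℕ) (ℓ : Fin 2) where

  open Book n

  root other : Vertex
  root  = vertex zero ℓ
  other = vertex zero (opposite ℓ)

  open Deliveries n ℓ root

  core : Config B → ℕ → ℕ → ℕ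
  core φ = spineCore (φ root) (φ other)

  core-moves : ∀ {φ ψ q dx dy} → q ≢ zero → Delivery φ ψ q dx dy → core ψ 0 0 ≡ core φ dx dy
  core-moves {dx = dx} {dy} _ d =
    cong₂ spineDeficiency (trans (Delivery.spine-top d) (+-comm _ dx))
                           (trans (Delivery.spine-bottom d) (+-comm _ dy))

  vanishing : ∀ φ → core φ 0 0 ≡ 0 → Solvable B root φ
  vanishing φ D≡0 with spine-vanishes (φ root) (φ other) D≡0
  ... | inj₁ 1≤ = done 1≤
  ... | inj₂ 2≤ = step other root (rung zero (l≢opposite ℓ ∘ sym)) 2≤
                    (done (subst (1 ≤_) (sym (move-target φ (vertex-≢ˡ zero zero (l≢opposite ℓ ∘ sym)))) (s≤s z≤n)))

  open ColumnInduction (_≢ zero) id core core-moves vanishing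
         (λ φ 0<D → allDeliverable⇒deliverable (core φ) (proj₂ (proj₂ (spine-interior (φ root) (φ other) 0<D))))

  upper : ∀ φ → size B φ ≡ 2 * n + 2 → Solvable B root φ
  upper φ size≡ with core φ 0 0 Nat.≟ 0
  ... | yes D≡0 = vanishing φ D≡0
  ... | no D≢0 with spine-interior (φ root) (φ other) (n≢0⇒n>0 D≢0)
  ...   | root≡0 , other<2 , _ = solvable-by-columns n suc suc-injective (λ _ ()) φ (≤-reflexive enough)
    where
    open ≡-Reasoning
    D+c≡2 : core φ 0 0 + colSum φ zero ≡ 2
    D+c≡2 rewrite colSum-level φ zero ℓ | root≡0 = m∸n+n≡m (<⇒≤ other<2)
    enough : 2 * n + core φ 0 0 ≡ sumFin n (colSum φ ∘ suc)
    enough = +-cancelˡ-≡ (colSum φ zero) _ _ (begin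
      colSum φ zero + (2 * n + core φ 0 0)   ≡⟨ swap (colSum φ zero) (2 * n) (core φ 0 0) ⟩
      2 * n + (core φ 0 0 + colSum φ zero)   ≡⟨ cong (2 * n +_) D+c≡2 ⟩
      2 * n + 2                              ≡⟨ size≡ ⟨
      size B φ                               ≡⟨ size-columns φ ⟩
      colSum φ zero + sumFin n (colSum φ ∘ suc) ∎)
      where
      swap : ∀ c a d → c + (a + d) ≡ a + (d + c)
      swap = solve-∀

  number : IsRootedPebblingNumber B root (2 * n + 2)
  number = isRootedPebblingNumber (ones-except {G = B} root) (ones-except-unsolvable root)
             (trans (order-eq n) (order≡suc-size-ones-except {G = B} root)) upper
    where
    order-eq : ∀ n → 2 * n + 2 ≡ suc n * 2
    order-eq = solve-∀

-- Leaf roots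

module LeafRoot (m : ℕ) (j′ : Fin (suc (suc m))) (ℓ : Fin 2) where

  open Book (suc (suc m))

  j : Fin (3 + m)
  j = suc j′

  root spineTop spineBottom far : Vertex
  root        = vertex j ℓ
  spineTop    = vertex zero ℓ
  spineBottom = vertex zero (opposite ℓ)
  far         = vertex j (opposite ℓ)

  weight : Fin (3 + m) → ℕ → ℕ → ℕ
  weight zero    = linear 4 2
  weight (suc q) = if does (q ≟ j′) then linear 8 4 else columnWeight

  weight-suc : ∀ q → weight (suc q) ≡ linear 8 4 ⊎ weight (suc q) ≡ columnWeight
  weight-suc q with q ≟ j′
  ... | yes _ = inj₁ refl
  ... | no _  = inj₂ refl

  columnPotential : Config B → Fin (3 + m) → ℕ
  columnPotential φ q = weight q (φ (vertex q ℓ)) (φ (vertex q (opposite ℓ)))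

  potential : Config B → ℕ
  potential φ = sumFin (3 + m) (columnPotential φ)

  -- The column weights seen from a level l, with u the value of the spine vertex on level l.
  record Orientation (l : Fin 2) : Set where
    field
      u        : ℕ
      R        : Fin (3 + m) → ℕ → ℕ → ℕ
      reads    : ∀ φ q → columnPotential φ q ≡ R q (φ (vertex q l)) (φ (vertex q (opposite l)))
      law      : ∀ q → ColumnWeight u (R q)
      spine    : ∀ a b → R zero (suc a) b ≡ R zero a b + u

  top : Orientation ℓ
  top = record { u = 4 ; R = weight ; reads = λ _ _ → refl ; law = law ; spine = spine }
    where
    law : ∀ q → ColumnWeight 4 (weight q)
    law zero = linear-weight {4} {4} {2} (from-yes (4 ≤? 8)) (from-yes (4 ≤? 8)) (from-yes (2 ≤? 8))
    law (suc q) with weight-suc q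
    ... | inj₁ eq = subst (ColumnWeight 4) (sym eq)
                      (linear-weight {4} {8} {4} (from-yes (4 ≤? 16)) (from-yes (8 ≤? 8)) (from-yes (4 ≤? 16)))
    ... | inj₂ eq = subst (ColumnWeight 4) (sym eq) columnWeight-top
    spine : ∀ a b → 4 * suc a + 2 * b ≡ 4 * a + 2 * b + 4
    spine = solve-∀

  bottom : Orientation (opposite ℓ)
  bottom = record { u = 2 ; R = flip ∘ weight ; reads = reads ; law = law ; spine = spine }
    where
    reads : ∀ φ q →
            columnPotential φ q ≡ weight q (φ (vertex q (opposite (opposite ℓ)))) (φ (vertex q (opposite ℓ)))
    reads φ q rewrite opposite-involutive ℓ = refl
    swapped : ∀ {u} c d → ColumnWeight u (linear d c) → ColumnWeight u (flip (linear c d))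
    swapped c d = ColumnWeight-cong (λ a b → +-comm (d * a) (c * b))
    law : ∀ q → ColumnWeight 2 (flip (weight q))
    law zero = swapped 4 2 (linear-weight {2} {2} {4} (from-yes (2 ≤? 4)) (from-yes (2 ≤? 4)) (from-yes (4 ≤? 4)))
    law (suc q) with weight-suc q
    ... | inj₁ eq = subst (ColumnWeight 2 ∘ flip) (sym eq)
                      (swapped 8 4 (linear-weight {2} {4} {8} (from-yes (2 ≤? 8)) (from-yes (4 ≤? 4))
                                                               (from-yes (8 ≤? 8))))
    ... | inj₂ eq = subst (ColumnWeight 2 ∘ flip) (sym eq) columnWeight-bottom
    spine : ∀ a b → 4 * b + 2 * suc a ≡ 4 * b + 2 * a + 2
    spine = solve-∀

  orientation : ∀ l → Orientation l
  orientation l with level-cases ℓ l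
  ... | inj₁ refl = top
  ... | inj₂ refl = bottom

  columnPotential-move : ∀ φ {p lp q lq} i → i ≢ p → i ≢ q →
    columnPotential (move B φ (vertex p lp) (vertex q lq)) i ≡ columnPotential φ i
  columnPotential-move φ {p} {lp} {q} {lq} i i≢p i≢q =
    cong₂ (weight i) (move-other φ (vertex-≢ʳ ℓ lp i≢p) (vertex-≢ʳ ℓ lq i≢q))
                     (move-other φ (vertex-≢ʳ (opposite ℓ) lp i≢p) (vertex-≢ʳ (opposite ℓ) lq i≢q))

  module _ {l} (o : Orientation l) where
    open Orientation o

    private
      l̄ : Fin 2
      l̄ = opposite l
      l̄≢l : l̄ ≢ l
      l̄≢l = l≢opposite l ∘ sym

    spoke-potential : ∀ φ {p q} → p ≢ q → 2 ≤ φ (vertex p l) →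
      (∀ a b c d → R p a b + R q (suc c) d ≤ R p (2 + a) b + R q c d) →
      potential (move B φ (vertex p l) (vertex q l)) ≤ potential φ
    spoke-potential φ {p} {q} p≢q 2≤ ineq =
      sumFin-≤-two (3 + m) (columnPotential ψ) (columnPotential φ) p≢q (columnPotential-move φ) (begin
        columnPotential ψ p + columnPotential ψ q
          ≡⟨ cong₂ _+_ (reads ψ p) (reads ψ q) ⟩
        R p (ψ (vertex p l)) (ψ (vertex p l̄)) + R q (ψ (vertex q l)) (ψ (vertex q l̄))
          ≡⟨ cong₂ _+_
               (cong₂ (R p) (move-source φ pl≢ql) (move-other φ (vertex-≢ˡ p p l̄≢l) (vertex-≢ʳ l̄ l p≢q)))
               (cong₂ (R q) (move-target φ pl≢ql) (move-other φ (vertex-≢ʳ l̄ l (p≢q ∘ sym)) (vertex-≢ˡ q q l̄≢l))) ⟩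
        R p (φ (vertex p l) ∸ 2) (φ (vertex p l̄)) + R q (suc (φ (vertex q l))) (φ (vertex q l̄))
          ≤⟨ ineq _ _ _ _ ⟩
        R p (2 + (φ (vertex p l) ∸ 2)) (φ (vertex p l̄)) + R q (φ (vertex q l)) (φ (vertex q l̄))
          ≡⟨ cong (λ x → R p x (φ (vertex p l̄)) + R q (φ (vertex q l)) (φ (vertex q l̄))) (m+[n∸m]≡n 2≤) ⟩
        R p (φ (vertex p l)) (φ (vertex p l̄)) + R q (φ (vertex q l)) (φ (vertex q l̄))
          ≡⟨ cong₂ _+_ (reads φ p) (reads φ q) ⟨
        columnPotential φ p + columnPotential φ q ∎)
      where
      open ≤-Reasoning
      ψ : Config B
      ψ = move B φ (vertex p l) (vertex q l)
      pl≢ql : vertex p l ≢ vertex q l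
      pl≢ql = vertex-≢ʳ l l p≢q

    spoke-out-potential : ∀ φ {q} → q ≢ zero → 2 ≤ φ (vertex zero l) →
      potential (move B φ (vertex zero l) (vertex q l)) ≤ potential φ
    spoke-out-potential φ {q} q≢0 2≤ = spoke-potential φ (q≢0 ∘ sym) 2≤ λ a b c d → begin
      R zero a b + R q (suc c) d          ≤⟨ +-monoʳ-≤ (R zero a b) (ColumnWeight.receive (law q) c d) ⟩
      R zero a b + (R q c d + 2 * u)      ≡⟨ shuffle (R zero a b) (R q c d) u ⟩
      R zero a b + u + u + R q c d        ≡⟨ cong (λ x → x + u + R q c d) (spine a b) ⟨
      R zero (suc a) b + u + R q c d      ≡⟨ cong (_+ R q c d) (spine (suc a) b) ⟨
      R zero (2 + a) b + R q c d          ∎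
      where
      open ≤-Reasoning
      shuffle : ∀ s r u → s + (r + 2 * u) ≡ s + u + u + r
      shuffle = solve-∀

    spoke-in-potential : ∀ φ {q} → q ≢ zero → 2 ≤ φ (vertex q l) →
      potential (move B φ (vertex q l) (vertex zero l)) ≤ potential φ
    spoke-in-potential φ {q} q≢0 2≤ = spoke-potential φ q≢0 2≤ λ a b c d → begin
      R q a b + R zero (suc c) d          ≡⟨ cong (R q a b +_) (spine c d) ⟩
      R q a b + (R zero c d + u)          ≡⟨ shuffle (R q a b) (R zero c d) u ⟩
      R q a b + u + R zero c d            ≤⟨ +-monoˡ-≤ (R zero c d) (ColumnWeight.send (law q) a b) ⟩
      R q (2 + a) b + R zero c d          ∎
      where
      open ≤-Reasoning
      shuffle : ∀ s r u → s + (r + u) ≡ s + u + r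
      shuffle = solve-∀

    rung-potential : ∀ φ q → 2 ≤ φ (vertex q l) →
      potential (move B φ (vertex q l) (vertex q l̄)) ≤ potential φ
    rung-potential φ q 2≤ = sumFin-mono (3 + m) column≤
      where
      ψ : Config B
      ψ = move B φ (vertex q l) (vertex q l̄)
      ql≢ql̄ : vertex q l ≢ vertex q l̄
      ql≢ql̄ = vertex-≢ˡ q q (l≢opposite l)
      column≤ : ∀ i → columnPotential ψ i ≤ columnPotential φ i
      column≤ i with i ≟ q
      ... | no i≢q    = ≤-reflexive (columnPotential-move φ i i≢q i≢q)
      ... | yes refl  = begin
        columnPotential ψ i                                ≡⟨ reads ψ i ⟩
        R i (ψ (vertex i l)) (ψ (vertex i l̄))
          ≡⟨ cong₂ (R i) (move-source φ ql≢ql̄) (move-target φ ql≢ql̄) ⟩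
        R i (φ (vertex i l) ∸ 2) (suc (φ (vertex i l̄)))    ≤⟨ ColumnWeight.shift (law i) _ _ ⟩
        R i (2 + (φ (vertex i l) ∸ 2)) (φ (vertex i l̄))    ≡⟨ cong (λ x → R i x (φ (vertex i l̄))) (m+[n∸m]≡n 2≤) ⟩
        R i (φ (vertex i l)) (φ (vertex i l̄))              ≡⟨ reads φ i ⟨
        columnPotential φ i                                ∎
        where open ≤-Reasoning

  potential-move : ∀ φ u v → Adj B u v → 2 ≤ φ u → potential (move B φ u v) ≤ potential φ
  potential-move φ u v = edge-coordinates (λ u v → 2 ≤ φ u → potential (move B φ u v) ≤ potential φ) in-coordinates
    where
    in-coordinates : ∀ {qu lu qv lv} → SpokeOrRung qu lu qv lv → 2 ≤ φ (vertex qu lu) →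
                     potential (move B φ (vertex qu lu) (vertex qv lv)) ≤ potential φ
    in-coordinates (inj₁ (inj₁ (refl , q≢0) , refl)) = spoke-out-potential (orientation _) φ q≢0
    in-coordinates (inj₁ (inj₂ (q≢0 , refl) , refl)) = spoke-in-potential (orientation _) φ q≢0
    in-coordinates {q} {l} (inj₂ (refl , l≢l′)) with ≢⇒opposite l≢l′
    ... | refl = rung-potential (orientation l) φ q

  weight-root : weight j ≡ linear 8 4
  weight-root with j′ ≟ j′
  ... | yes _    = refl
  ... | no j′≢j′ = contradiction refl j′≢j′

  root≤potential : ∀ φ → 8 * φ root ≤ potential φ
  root≤potential φ = begin
    8 * φ root                                     ≤⟨ m≤m+n (8 * φ root) _ ⟩
    linear 8 4 (φ root) (φ far)                    ≡⟨ cong (λ R → R (φ root) (φ far)) weight-root ⟨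
    columnPotential φ j                            ≤⟨ sumFin-lookup (3 + m) (columnPotential φ) j ⟩
    potential φ                                    ∎
    where open ≤-Reasoning

  potential≤7-unsolvable : ∀ φ → potential φ ≤ 7 → ¬ Solvable B root φ
  potential≤7-unsolvable φ ≤7 (done 1≤) =
    contradiction (≤-trans (*-monoʳ-≤ 8 1≤) (≤-trans (root≤potential φ) ≤7)) (<⇒≱ (s≤s ≤-refl))
  potential≤7-unsolvable φ ≤7 (step u v u~v 2≤ s) =
    potential≤7-unsolvable (move B φ u v) (≤-trans (potential-move φ u v u~v 2≤) ≤7) s

  ordinary : Fin (suc m) → Fin (3 + m)
  ordinary k = suc (punchIn j′ k)

  ordinary≢j : ∀ k → ordinary k ≢ j
  ordinary≢j k = punchInᵢ≢i j′ k ∘ suc-injective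

  sumFin-columns : ∀ (f : Fin (3 + m) → ℕ) → sumFin (3 + m) f ≡ f zero + (f j + sumFin (suc m) (f ∘ ordinary))
  sumFin-columns f = cong (f zero +_) (sumFin-remove (suc m) (f ∘ suc) j′)

  weight-ordinary : ∀ k → weight (ordinary k) ≡ columnWeight
  weight-ordinary k with punchIn j′ k ≟ j′
  ... | yes eq = contradiction eq (punchInᵢ≢i j′ k)
  ... | no _   = refl

  cell : Fin (3 + m) → Fin 2 → ℕ
  cell zero    l = 0
  cell (suc q) l with q ≟ j′ | q ≟ punchIn j′ zero | l ≟ ℓ
  ... | yes _ | _     | _     = 0
  ... | no _  | yes _ | yes _ = 0
  ... | no _  | yes _ | no _  = 7
  ... | no _  | no _  | _     = 1

  heavy : Config B
  heavy w = uncurry cell (remQuot 2 w)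

  heavy-vertex : ∀ q l → heavy (vertex q l) ≡ cell q l
  heavy-vertex q l = cong (uncurry cell) (remQuot-combine q l)

  cell-root-column : ∀ l → cell j l ≡ 0
  cell-root-column l with j′ ≟ j′
  ... | yes _    = refl
  ... | no j′≢j′ = contradiction refl j′≢j′

  cell-first-ℓ : cell (ordinary zero) ℓ ≡ 0
  cell-first-ℓ with punchIn j′ zero ≟ j′ | punchIn j′ zero ≟ punchIn j′ zero | ℓ ≟ ℓ
  ... | yes eq | _     | _     = contradiction eq (punchInᵢ≢i j′ zero)
  ... | no _   | no ne | _     = contradiction refl ne
  ... | no _   | yes _ | no ne = contradiction refl ne
  ... | no _   | yes _ | yes _ = refl

  cell-first-ℓ̄ : cell (ordinary zero) (opposite ℓ) ≡ 7
  cell-first-ℓ̄ with punchIn j′ zero ≟ j′ | punchIn j′ zero ≟ punchIn j′ zero | opposite ℓ ≟ ℓ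
  ... | yes eq | _      | _      = contradiction eq (punchInᵢ≢i j′ zero)
  ... | no _   | no ne  | _      = contradiction refl ne
  ... | no _   | yes _  | yes eq = contradiction (sym eq) (l≢opposite ℓ)
  ... | no _   | yes _  | no _   = refl

  cell-rest : ∀ k l → cell (ordinary (suc k)) l ≡ 1
  cell-rest k l with punchIn j′ (suc k) ≟ j′ | punchIn j′ (suc k) ≟ punchIn j′ zero
  ... | yes eq | _      = contradiction eq (punchInᵢ≢i j′ (suc k))
  ... | no _   | yes eq = contradiction (punchIn-injective j′ (suc k) zero eq) λ ()
  ... | no _   | no _   = refl

  sumFin-kinds : ∀ (f : Fin (3 + m) → ℕ) {d} → (∀ k → f (ordinary (suc k)) ≡ d) →
                 sumFin (3 + m) f ≡ f zero + (f j + (f (ordinary zero) + m * d))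
  sumFin-kinds f {d} rest≡d = trans (sumFin-columns f)
    (cong (λ s → f zero + (f j + (f (ordinary zero) + s))) (trans (sumFin-cong m rest≡d) (sumFin-const m d)))

  heavy-potential : potential heavy ≡ 6
  heavy-potential = trans (sumFin-kinds cp rest) total
    where
    cp : Fin (3 + m) → ℕ
    cp = columnPotential heavy
    at : ∀ q → cp q ≡ weight q (cell q ℓ) (cell q (opposite ℓ))
    at q = cong₂ (weight q) (heavy-vertex q ℓ) (heavy-vertex q (opposite ℓ))
    spine : cp zero ≡ 0
    spine = at zero
    root-column : cp j ≡ 0
    root-column rewrite at j | weight-root | cell-root-column ℓ | cell-root-column (opposite ℓ) = refl
    first : cp (ordinary zero) ≡ 6
    first rewrite at (ordinary zero) | weight-ordinary zero | cell-first-ℓ | cell-first-ℓ̄ = refl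
    rest : ∀ k → cp (ordinary (suc k)) ≡ 0
    rest k rewrite at (ordinary (suc k)) | weight-ordinary (suc k) | cell-rest k ℓ | cell-rest k (opposite ℓ) = refl
    total : cp zero + (cp j + (cp (ordinary zero) + m * 0)) ≡ 6
    total rewrite spine | root-column | first | *-zeroʳ m = refl

  heavy-size : size B heavy ≡ 7 + m * 2
  heavy-size = trans (size-columns heavy) (trans (sumFin-kinds cs rest) total)
    where
    cs : Fin (3 + m) → ℕ
    cs = colSum heavy
    at : ∀ q → cs q ≡ cell q ℓ + cell q (opposite ℓ)
    at q = trans (colSum-level heavy q ℓ) (cong₂ _+_ (heavy-vertex q ℓ) (heavy-vertex q (opposite ℓ)))
    spine : cs zero ≡ 0
    spine = at zero
    root-column : cs j ≡ 0
    root-column rewrite at j | cell-root-column ℓ | cell-root-column (opposite ℓ) = refl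
    first : cs (ordinary zero) ≡ 7
    first rewrite at (ordinary zero) | cell-first-ℓ | cell-first-ℓ̄ = refl
    rest : ∀ k → cs (ordinary (suc k)) ≡ 2
    rest k rewrite at (ordinary (suc k)) | cell-rest k ℓ | cell-rest k (opposite ℓ) = refl
    total : cs zero + (cs j + (cs (ordinary zero) + m * 2)) ≡ 7 + m * 2
    total rewrite spine | root-column | first = refl

  ordinary-injective : Injective _≡_ _≡_ ordinary
  ordinary-injective {k} {k′} eq = punchIn-injective j′ k k′ (suc-injective eq)

  private
    j≢0 : j ≢ zero
    j≢0 ()
    ℓ̄≢ℓ : opposite ℓ ≢ ℓ
    ℓ̄≢ℓ = l≢opposite ℓ ∘ sym

  arrives : ∀ φ {u} → u ≢ root → 1 ≤ move B φ u root root
  arrives φ u≢r = subst (1 ≤_) (sym (move-target φ u≢r)) (s≤s z≤n)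

  from-spineTop : ∀ φ → 2 ≤ φ spineTop → Solvable B root φ
  from-spineTop φ 2≤ = step spineTop root (spoke-out ℓ j≢0) 2≤ (done (arrives φ (vertex-≢ʳ ℓ ℓ (j≢0 ∘ sym))))

  from-far : ∀ φ → 2 ≤ φ far → Solvable B root φ
  from-far φ 2≤ = step far root (rung j ℓ̄≢ℓ) 2≤ (done (arrives φ (vertex-≢ˡ j j ℓ̄≢ℓ)))

  via-spineBottom : ∀ φ → 2 ≤ φ spineBottom → 1 ≤ φ spineTop → Solvable B root φ
  via-spineBottom φ 2≤ 1≤ = step spineBottom spineTop (rung zero ℓ̄≢ℓ) 2≤
    (from-spineTop _ (subst (2 ≤_) (sym (move-target φ (vertex-≢ˡ zero zero ℓ̄≢ℓ))) (s≤s 1≤)))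

  hub-solvable : ∀ φ → Hub (φ spineTop) (φ spineBottom) (φ far) → Solvable B root φ
  hub-solvable φ (inj₁ 2≤x)                         = from-spineTop φ 2≤x
  hub-solvable φ (inj₂ (inj₁ 2≤z))                  = from-far φ 2≤z
  hub-solvable φ (inj₂ (inj₂ (inj₁ 4≤y)))           =
    step spineBottom spineTop (rung zero ℓ̄≢ℓ) (≤-trans (s≤s (s≤s z≤n)) 4≤y)
    (via-spineBottom _ (subst (2 ≤_) (sym (move-source φ c1≢c0)) (2+m≤n⇒m≤n∸2 4≤y))
                       (subst (1 ≤_) (sym (move-target φ c1≢c0)) (s≤s z≤n)))
    where
    c1≢c0 : spineBottom ≢ spineTop
    c1≢c0 = vertex-≢ˡ zero zero ℓ̄≢ℓ
  hub-solvable φ (inj₂ (inj₂ (inj₂ (2≤y , inj₁ 1≤x)))) = via-spineBottom φ 2≤y 1≤x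
  hub-solvable φ (inj₂ (inj₂ (inj₂ (2≤y , inj₂ 1≤z)))) = step spineBottom far (spoke-out (opposite ℓ) j≢0) 2≤y
    (from-far _ (subst (2 ≤_) (sym (move-target φ (vertex-≢ʳ (opposite ℓ) (opposite ℓ) (j≢0 ∘ sym)))) (s≤s 1≤z)))

  open Deliveries (suc (suc m)) ℓ root

  core : Config B → ℕ → ℕ → ℕ
  core φ = leafCore (φ spineTop) (φ spineBottom) (φ far)

  Ordinary : Fin (3 + m) → Set
  Ordinary q = q ≢ zero × q ≢ j

  core-moves : ∀ {φ ψ q dx dy} → Ordinary q → Delivery φ ψ q dx dy → core ψ 0 0 ≡ core φ dx dy
  core-moves {φ} {ψ} {dx = dx} {dy} (q≢0 , q≢j) d = trans
    (cong₂ (λ x y → leafDeficiency x y (ψ far)) (trans (Delivery.spine-top d) (+-comm _ dx))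
                                                 (trans (Delivery.spine-bottom d) (+-comm _ dy)))
    (cong (leafDeficiency (dx + φ spineTop) (dy + φ spineBottom))
          (Delivery.elsewhere d j (opposite ℓ) j≢0 (q≢j ∘ sym)))

  vanishing : ∀ φ → core φ 0 0 ≡ 0 → Solvable B root φ
  vanishing φ = hub-solvable φ ∘ leaf-vanishes _ _ _

  open ColumnInduction Ordinary proj₁ core core-moves vanishing
         (λ φ 0<D → allDeliverable⇒deliverable (core φ) (proj₂ (proj₂ (leaf-interior _ _ _ 0<D))))

  upper : ∀ φ → size B φ ≡ 2 * (2 + m) + 4 → Solvable B root φ
  upper φ size≡ with φ root Nat.≟ 0 | core φ 0 0 Nat.≟ 0
  ... | no root≢0  | _        = done (n≢0⇒n>0 root≢0)
  ... | yes _      | yes D≡0  = vanishing φ D≡0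
  ... | yes root≡0 | no D≢0   =
    solvable-by-columns (suc m) ordinary ordinary-injective (λ k → (λ ()) , ordinary≢j k) φ enough
    where
    x y z D S : ℕ
    x = φ spineTop
    y = φ spineBottom
    z = φ far
    D = core φ 0 0
    S = sumFin (suc m) (colSum φ ∘ ordinary)
    bound : D + (x + (y + z)) ≤ 6
    bound = proj₁ (proj₂ (leaf-interior x y z (n≢0⇒n>0 D≢0)))
    columns : size B φ ≡ (x + y) + (z + S)
    columns = begin
      size B φ                                ≡⟨ size-columns φ ⟩
      sumFin (3 + m) (colSum φ)               ≡⟨ sumFin-columns (colSum φ) ⟩
      colSum φ zero + (colSum φ j + S)        ≡⟨ cong₂ (λ c c′ → c + (c′ + S)) (colSum-level φ zero ℓ)
                                                  (trans (colSum-level φ j ℓ) (cong (_+ z) root≡0)) ⟩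
      (x + y) + (z + S)                       ∎
      where open ≡-Reasoning
    enough : 2 * suc m + D ≤ S
    enough = +-cancelʳ-≤ (x + (y + z)) (2 * suc m + D) S (begin
      2 * suc m + D + (x + (y + z))           ≡⟨ +-assoc (2 * suc m) D _ ⟩
      2 * suc m + (D + (x + (y + z)))         ≤⟨ +-monoʳ-≤ (2 * suc m) bound ⟩
      2 * suc m + 6                           ≡⟨ total m ⟩
      2 * (2 + m) + 4                         ≡⟨ size≡ ⟨
      size B φ                                ≡⟨ columns ⟩
      (x + y) + (z + S)                       ≡⟨ rearrange x y z S ⟩
      S + (x + (y + z))                       ∎)
      where
      open ≤-Reasoning
      total : ∀ m → 2 * suc m + 6 ≡ 2 * (2 + m) + 4
      total = solve-∀
      rearrange : ∀ x y z S → (x + y) + (z + S) ≡ S + (x + (y + z))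
      rearrange = solve-∀

  number : IsRootedPebblingNumber B root (2 * (2 + m) + 4)
  number = isRootedPebblingNumber heavy
             (potential≤7-unsolvable heavy (≤-trans (≤-reflexive heavy-potential) (n≤1+n 6)))
             (trans (size-eq m) (cong suc (sym heavy-size))) upper
    where
    size-eq : ∀ m → 2 * (2 + m) + 4 ≡ suc (7 + m * 2)
    size-eq = solve-∀

book-pebbling-number : ∀ m → IsPebblingNumber (book (2 + m)) (2 * (2 + m) + 4)
book-pebbling-number m = every-root , vertex (suc zero) zero , LeafRoot.number m zero zero
  where
  open Book (2 + m)
  Bounded : Vertex → Set
  Bounded r = Σ ℕ λ k → IsRootedPebblingNumber B r k × k ≤ 2 * (2 + m) + 4
  rooted : ∀ q l → Bounded (vertex q l)
  rooted zero     l = _ , SpineRoot.number (2 + m) l , +-monoʳ-≤ (2 * (2 + m)) (s≤s (s≤s z≤n))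
  rooted (suc j′) l = _ , LeafRoot.number m j′ l , ≤-refl
  every-root : ∀ r → Bounded r
  every-root r = subst Bounded (vertex-column-level r) (rooted (column r) (level r))

mainTheorem3 : IsPebblingNumber (book 2) 8
               × (∀ (n : ℕ) → 2 ≤ n → IsPebblingNumber (book n) (2 * n + 4))
mainTheorem3 = book-pebbling-number 0 , λ { (suc (suc m)) _ → book-pebbling-number m ; (suc zero) (s≤s ()) }
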